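{- Let $k$ be a positive integer and let $G \cong P_3 + H$ be a cograph minimal $(\infty,k)$-polar obstruction. If $H$ is not $(1,k)$-polar, then $H$ is a connected non-complete graph.
   Context: All graphs are finite and simple. A cograph is a graph with no induced subgraph isomorphic to $P_4$. $G+H$ denotes disjoint union; $P_3$ is the path on 3 vertices. A cluster is a disjoint union of complete graphs. For $s,k \in \mathbb{Z}_{\ge 0}\cup\{\infty\}$, an $(s,k)$-polar partition of $G$ is a partition $(A,B)$ of $V(G)$ (parts may be empty) such that $G[A]$ is a complete multipartite graph with at most $s$ parts and $G[B]$ is a cluster with at most $k$ components; $\infty$ means unbounded. $G$ is $(s,k)$-polar if it has such a partition. A cograph minimal $(s,k)$-polar obstruction is a cograph that is not $(s,k)$-polar but all of whose proper induced subgraphs are $(s,k)$-polar. -}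

module Defs where

open import Data.Nat using (ℕ; zero; suc; _+_; _<_; _≤_)
open import Data.Fin using (Fin; zero; suc; splitAt)
open import Data.Bool using (Bool; true; false; _∧_)
open import Data.Sum using (_⊎_; inj₁; inj₂)
open import Data.Product using (Σ; _×_; _,_; ∃; ∃-syntax)
open import Relation.Binary.PropositionalEquality using (_≡_; _≢_)
open import Relation.Nullary using (¬_)
open import Function.Definitions using (Injective)

record Graph : Set where
  field
    n     : ℕ
    adj   : Fin n → Fin n → Bool
    sym   : ∀ u v → adj u v ≡ adj v u
    irref : ∀ u → adj u u ≡ false
open Graph public

induce : (G : Graph) {m : ℕ} (f : Fin m → Fin (n G)) → Graph
induce G {m} f = record
  { n = m
  ; adj = λ i j → adj G (f i) (f j)
  ; sym = λ i j → sym G (f i) (f j)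
  ; irref = λ i → irref G (f i) }

record _≅_ (G H : Graph) : Set where
  field
    to      : Fin (n G) → Fin (n H)
    from    : Fin (n H) → Fin (n G)
    from-to : ∀ u → from (to u) ≡ u
    to-from : ∀ v → to (from v) ≡ v
    pres    : ∀ u v → adj H (to u) (to v) ≡ adj G u v

unionAdj : (G H : Graph) → Fin (n G) ⊎ Fin (n H) → Fin (n G) ⊎ Fin (n H) → Bool
unionAdj G H (inj₁ u) (inj₁ v) = adj G u v
unionAdj G H (inj₂ u) (inj₂ v) = adj H u v
unionAdj G H (inj₁ u) (inj₂ v) = false
unionAdj G H (inj₂ u) (inj₁ v) = false

unionSym : (G H : Graph) → ∀ x y → unionAdj G H x y ≡ unionAdj G H y x
unionSym G H (inj₁ u) (inj₁ v) = sym G u v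
unionSym G H (inj₂ u) (inj₂ v) = sym H u v
unionSym G H (inj₁ u) (inj₂ v) = Relation.Binary.PropositionalEquality.refl
unionSym G H (inj₂ u) (inj₁ v) = Relation.Binary.PropositionalEquality.refl

unionIrr : (G H : Graph) → ∀ x → unionAdj G H x x ≡ false
unionIrr G H (inj₁ u) = irref G u
unionIrr G H (inj₂ u) = irref H u

_⊕_ : Graph → Graph → Graph
G ⊕ H = record
  { n = n G + n H
  ; adj = λ u v → unionAdj G H (splitAt (n G) u) (splitAt (n G) v)
  ; sym = λ u v → unionSym G H (splitAt (n G) u) (splitAt (n G) v)
  ; irref = λ u → unionIrr G H (splitAt (n G) u) }

p3adj : Fin 3 → Fin 3 → Bool
p3adj zero (suc zero) = true
p3adj (suc zero) zero = true
p3adj (suc zero) (suc (suc zero)) = true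
p3adj (suc (suc zero)) (suc zero) = true
p3adj _ _ = false

P3 : Graph
P3 = record { n = 3 ; adj = p3adj ; sym = s ; irref = i }
  where
  open Relation.Binary.PropositionalEquality using (refl)
  s : ∀ u v → p3adj u v ≡ p3adj v u
  s zero zero = refl
  s zero (suc zero) = refl
  s zero (suc (suc zero)) = refl
  s (suc zero) zero = refl
  s (suc zero) (suc zero) = refl
  s (suc zero) (suc (suc zero)) = refl
  s (suc (suc zero)) zero = refl
  s (suc (suc zero)) (suc zero) = refl
  s (suc (suc zero)) (suc (suc zero)) = refl
  i : ∀ u → p3adj u u ≡ false
  i zero = refl
  i (suc zero) = refl
  i (suc (suc zero)) = refl

p4adj : Fin 4 → Fin 4 → Bool
p4adj zero (suc zero) = true
p4adj (suc zero) zero = true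
p4adj (suc zero) (suc (suc zero)) = true
p4adj (suc (suc zero)) (suc zero) = true
p4adj (suc (suc zero)) (suc (suc (suc zero))) = true
p4adj (suc (suc (suc zero))) (suc (suc zero)) = true
p4adj _ _ = false

HasInducedP4 : Graph → Set
HasInducedP4 G = Σ (Fin 4 → Fin (n G)) λ f →
  Injective _≡_ _≡_ f × (∀ i j → adj G (f i) (f j) ≡ p4adj i j)

Cograph : Graph → Set
Cograph G = ¬ HasInducedP4 G

data ℕ∞ : Set where
  fin : ℕ → ℕ∞
  ∞   : ℕ∞

-- Labels for parts/components: Fin s if the bound is s, ℕ if unbounded.
Label : ℕ∞ → Set
Label (fin s) = Fin s
Label ∞ = ℕ

-- (s,k)-polar partition: side u ≡ true means u ∈ A, false means u ∈ B.
-- G[A] is complete multipartite with at most s parts: a labelling of A by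
-- at most s part-labels such that distinct vertices of A are adjacent iff
-- they lie in different parts.  G[B] is a cluster with at most k
-- components: a labelling of B by at most k labels such that distinct
-- vertices of B are adjacent iff they have the same label.
record PolarPartition (s k : ℕ∞) (G : Graph) : Set where
  field
    side : Fin (n G) → Bool
    part : Fin (n G) → Label s
    comp : Fin (n G) → Label k
    multipartite : ∀ u v → side u ≡ true → side v ≡ true → u ≢ v →
                   (adj G u v ≡ true → part u ≢ part v) ×
                   (part u ≢ part v → adj G u v ≡ true)
    cluster : ∀ u v → side u ≡ false → side v ≡ false → u ≢ v →
              (adj G u v ≡ true → comp u ≡ comp v) ×
              (comp u ≡ comp v → adj G u v ≡ true)

Polar : ℕ∞ → ℕ∞ → Graph → Set
Polar s k G = PolarPartition s k G

MinimalObstruction : ℕ∞ → ℕ∞ → Graph → Set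
MinimalObstruction s k G =
  ¬ Polar s k G ×
  (∀ {m} (f : Fin m → Fin (n G)) → Injective _≡_ _≡_ f → m < n G →
     Polar s k (induce G f))

data Reach (G : Graph) : Fin (n G) → Fin (n G) → Set where
  here : ∀ {u} → Reach G u u
  step : ∀ {u v w} → adj G u v ≡ true → Reach G v w → Reach G u w

Connected : Graph → Set
Connected G = ∀ u v → Reach G u v

NonComplete : Graph → Set
NonComplete G = ∃[ u ] ∃[ v ] (u ≢ v × adj G u v ≡ false)

module Submission where

-- Deleting a vertex of G = P3 + H leaves an (s,k)-polar partition (A,B). If all of P3 survives,
-- A ∩ H is independent: a P3-vertex in A would share its part with both ends of an edge of H in A,
-- and P3 ⊆ B is impossible since P3 is not a cluster. So if some component of H were a clique, we
-- could delete one of its vertices y, get a (1,k)-polar partition of H − y, and put y back: into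
-- the cluster of a neighbour in B, else into a fresh cluster (the label of a P3-vertex in B is
-- unused on H), else into A when A ∩ H is empty. Deleting a vertex of P3 instead, A ∩ H must
-- contain an edge; every vertex of A ∩ H is adjacent to one of its ends, and a component of H
-- avoiding A lies in the cluster B, so it is a clique; hence H is connected. A complete H is a single cluster, hence (1,k)-polar.

open import Defs renaming (sym to adj-sym)
open import Data.Bool using (Bool; true; false; if_then_else_)
import Data.Bool.Properties as Bool
open import Data.Empty using (⊥-elim)
open import Data.Fin using (Fin; zero; suc; join; splitAt; punchIn; punchOut; _≟_)
open import Data.Fin.Properties
  using (any?; punchIn-injective; punchIn-punchOut; injective⇒≤; splitAt-join)
import Data.Nat as ℕ
open import Data.Nat using (ℕ; _≤_; s≤s)
open import Data.Product using (_×_; _,_; proj₁; proj₂; ∃)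
open import Data.Sum using (_⊎_; inj₁; inj₂; [_,_])
open import Data.Sum.Properties using (inj₂-injective)
open import Data.Unit using (⊤; tt)
open import Function using (_∘_; id)
open import Function.Definitions using (Injective)
open import Relation.Binary.Definitions using (DecidableEquality)
open import Relation.Binary.PropositionalEquality
  using (_≡_; _≢_; refl; sym; trans; cong; cong₂; ≢-sym; module ≡-Reasoning)
open import Relation.Nullary using (¬_; Dec; yes; no; contradiction)
open import Relation.Nullary.Decidable using (⌊_⌋; ¬?; _×-dec_; decidable-stable)

_≟ᴸ_ : ∀ {s} → DecidableEquality (Label s)
_≟ᴸ_ {fin _} = _≟_
_≟ᴸ_ {∞}     = ℕ._≟_

adj⇒≢ : (G : Graph) {u v : Fin (n G)} → adj G u v ≡ true → u ≢ v
adj⇒≢ G {u} uv refl = contradiction (trans (sym (irref G u)) uv) λ ()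

-- A polar partition of the subgraph induced by P; the labels of vertices outside P are ignored.
record PolarPartitionOn (s k : ℕ∞) {V : Set} (E : V → V → Bool) (P : V → Set) : Set where
  field
    side : V → Bool
    part : V → Label s
    comp : V → Label k
    multipartite : ∀ u v → P u → P v → side u ≡ true → side v ≡ true → u ≢ v →
                   (E u v ≡ true → part u ≢ part v) ×
                   (part u ≢ part v → E u v ≡ true)
    cluster : ∀ u v → P u → P v → side u ≡ false → side v ≡ false → u ≢ v →
              (E u v ≡ true → comp u ≡ comp v) ×
              (comp u ≡ comp v → E u v ≡ true)

  IndependentA : Set
  IndependentA = ∀ u v → P u → P v → side u ≡ true → side v ≡ true → E u v ≢ true

  part-≡ : ∀ {u v} → P u → P v → side u ≡ true → side v ≡ true → u ≢ v →
           E u v ≡ false → part u ≡ part v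
  part-≡ {u} {v} pu pv su sv u≢v uv = decidable-stable (part u ≟ᴸ part v) λ parts≢ →
    contradiction (trans (sym uv) (proj₂ (multipartite u v pu pv su sv u≢v) parts≢)) λ ()

open PolarPartitionOn

module _ {s k : ℕ∞} where

  Polar⇒On : {G : Graph} → Polar s k G → PolarPartitionOn s k (adj G) (λ _ → ⊤)
  Polar⇒On Π = record
    { side = PolarPartition.side Π
    ; part = PolarPartition.part Π
    ; comp = PolarPartition.comp Π
    ; multipartite = λ u v _ _ → PolarPartition.multipartite Π u v
    ; cluster = λ u v _ _ → PolarPartition.cluster Π u v }

  On⇒Polar : {G : Graph} → PolarPartitionOn s k (adj G) (λ _ → ⊤) → Polar s k G
  On⇒Polar Π = record
    { side = side Π
    ; part = part Π
    ; comp = comp Π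
    ; multipartite = λ u v → multipartite Π u v tt tt
    ; cluster = λ u v → cluster Π u v tt tt }

  pullback : {V W : Set} {E : V → V → Bool} {F : W → W → Bool} {P : V → Set} {Q : W → Set}
    (r : V → W) → (∀ v → P v → Q (r v)) →
    (∀ u v → P u → P v → F (r u) (r v) ≡ E u v) →
    (∀ u v → P u → P v → r u ≡ r v → u ≡ v) →
    PolarPartitionOn s k F Q → PolarPartitionOn s k E P
  pullback r r-Q r-adj r-inj Π = record
    { side = side Π ∘ r
    ; part = part Π ∘ r
    ; comp = comp Π ∘ r
    ; multipartite = λ u v pu pv su sv u≢v →
        let (to , from) = multipartite Π (r u) (r v) (r-Q u pu) (r-Q v pv) su sv
                            (u≢v ∘ r-inj u v pu pv)
            eq = r-adj u v pu pv
        in to ∘ trans eq , trans (sym eq) ∘ from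
    ; cluster = λ u v pu pv su sv u≢v →
        let (to , from) = cluster Π (r u) (r v) (r-Q u pu) (r-Q v pv) su sv
                            (u≢v ∘ r-inj u v pu pv)
            eq = r-adj u v pu pv
        in to ∘ trans eq , trans (sym eq) ∘ from }

  restrict : {V : Set} {E : V → V → Bool} {P Q : V → Set} →
    (∀ v → Q v → P v) → PolarPartitionOn s k E P → PolarPartitionOn s k E Q
  restrict Q⊆P = pullback id Q⊆P (λ _ _ _ _ → refl) (λ _ _ _ _ → id)

  merge-parts : {V : Set} {E : V → V → Bool} {P : V → Set} →
    (Π : PolarPartitionOn s k E P) → IndependentA Π → PolarPartitionOn (fin 1) k E P
  merge-parts Π independent = record
    { side = side Π
    ; part = λ _ → zero
    ; comp = comp Π
    ; multipartite = λ u v pu pv su sv _ →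
        (λ uv → ⊥-elim (independent u v pu pv su sv uv)) , (λ 0≢0 → ⊥-elim (0≢0 refl))
    ; cluster = cluster Π }

-- The deleted vertex x itself goes to the junk value zero, so the domain needs two vertices.
delete : ∀ {m} → Fin (ℕ.suc (ℕ.suc m)) → Fin (ℕ.suc (ℕ.suc m)) → Fin (ℕ.suc m)
delete x v with x ≟ v
... | yes _   = zero
... | no x≢v = punchOut x≢v

punchIn-delete : ∀ {m} (x v : Fin (ℕ.suc (ℕ.suc m))) → v ≢ x → punchIn x (delete x v) ≡ v
punchIn-delete x v v≢x with x ≟ v
... | yes x≡v = contradiction (sym x≡v) v≢x
... | no x≢v  = punchIn-punchOut x≢v

join-injective : ∀ m {k} → Injective _≡_ _≡_ (join m k)
join-injective m {k} {u} {v} e = begin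
  u                      ≡⟨ sym (splitAt-join m k u) ⟩
  splitAt m (join m k u) ≡⟨ cong (splitAt m) e ⟩
  splitAt m (join m k v) ≡⟨ splitAt-join m k v ⟩
  v                      ∎
  where open ≡-Reasoning

adj-⊕-join : ∀ G H u v → adj (G ⊕ H) (join (n G) (n H) u) (join (n G) (n H) v) ≡ unionAdj G H u v
adj-⊕-join G H u v = cong₂ (unionAdj G H) (splitAt-join (n G) (n H) u) (splitAt-join (n G) (n H) v)

module _ {G K : Graph} (iso : G ≅ K) where
  open _≅_ iso

  from-injective : Injective _≡_ _≡_ from
  from-injective {a} {b} e = trans (sym (to-from a)) (trans (cong to e) (to-from b))

  from-adj : ∀ a b → adj G (from a) (from b) ≡ adj K a b
  from-adj a b = trans (sym (pres (from a) (from b))) (cong₂ (adj K) (to-from a) (to-from b))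

module _ {s k : ℕ∞} {G : Graph} (minimal : MinimalObstruction s k G) where

  minimal-delete : ∀ {m} (f : Fin (ℕ.suc (ℕ.suc m)) → Fin (n G)) → Injective _≡_ _≡_ f →
    (x : Fin (ℕ.suc (ℕ.suc m))) → PolarPartitionOn s k (λ i j → adj G (f i) (f j)) (_≢ x)
  minimal-delete f f-inj x = pullback (delete x) (λ _ _ → tt) adjacency injective
    (Polar⇒On (proj₂ minimal (f ∘ punchIn x) (punchIn-injective x _ _ ∘ f-inj) (injective⇒≤ f-inj)))
    where
    restored : ∀ v → v ≢ x → punchIn x (delete x v) ≡ v
    restored = punchIn-delete x
    adjacency : ∀ u v → u ≢ x → v ≢ x →
      adj G (f (punchIn x (delete x u))) (f (punchIn x (delete x v))) ≡ adj G (f u) (f v)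
    adjacency u v u≢x v≢x = cong₂ (λ a b → adj G (f a) (f b)) (restored u u≢x) (restored v v≢x)
    injective : ∀ u v → u ≢ x → v ≢ x → delete x u ≡ delete x v → u ≡ v
    injective u v u≢x v≢x e =
      trans (sym (restored u u≢x)) (trans (cong (punchIn x) e) (restored v v≢x))

  sum-delete : ∀ {H} → G ≅ (P3 ⊕ H) → (x : Fin 3 ⊎ Fin (n H)) →
    PolarPartitionOn s k (unionAdj P3 H) (_≢ x)
  sum-delete {H} iso x =
    pullback (join 3 (n H)) (λ v v≢x → v≢x ∘ join-injective 3) adjacency
      (λ _ _ _ _ → join-injective 3)
      (minimal-delete (_≅_.from iso) (from-injective iso) (join 3 (n H) x))
    where
    adjacency : ∀ u v → u ≢ x → v ≢ x →
      adj G (_≅_.from iso (join 3 (n H) u)) (_≅_.from iso (join 3 (n H) v)) ≡ unionAdj P3 H u v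
    adjacency u v _ _ = trans (from-adj iso _ _) (adj-⊕-join P3 H u v)

module _ (G : Graph) where

  Reach-trans : ∀ {u v w} → Reach G u v → Reach G v w → Reach G u w
  Reach-trans here       r = r
  Reach-trans (step e q) r = step e (Reach-trans q r)

  Reach-sym : ∀ {u v} → Reach G u v → Reach G v u
  Reach-sym here                 = here
  Reach-sym (step {u} {v} e r) = Reach-trans (Reach-sym r) (step (trans (adj-sym G v u) e) here)

  connected-via : ∀ u₀ → (∀ v → Reach G v u₀) → Connected G
  connected-via u₀ reach u v = Reach-trans (reach u) (Reach-sym (reach v))

record CliqueComponent (G : Graph) (C : Fin (n G) → Set) : Set where
  field
    closed   : ∀ {u v} → C u → adj G u v ≡ true → C v
    complete : ∀ {u v} → C u → C v → u ≢ v → adj G u v ≡ true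

module _ {s k : ℕ∞} (G : Graph) {y : Fin (n G)} (Π : PolarPartitionOn s k (adj G) (_≢ y)) where
  private
    update : {A : Set} → A → (Fin (n G) → A) → Fin (n G) → A
    update a f v = if ⌊ v ≟ y ⌋ then a else f v

  extend : (sy : Bool) (py : Label s) (cy : Label k) →
    (sy ≡ true → ∀ v → v ≢ y → side Π v ≡ true →
       (adj G y v ≡ true → py ≢ part Π v) × (py ≢ part Π v → adj G y v ≡ true)) →
    (sy ≡ false → ∀ v → v ≢ y → side Π v ≡ false →
       (adj G y v ≡ true → cy ≡ comp Π v) × (cy ≡ comp Π v → adj G y v ≡ true)) →
    Polar s k G
  extend sy py cy toA toB = record
    { side = update sy (side Π)
    ; part = update py (part Π)
    ; comp = update cy (comp Π)
    ; multipartite = inA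
    ; cluster = inB }
    where
    inA : ∀ u v → update sy (side Π) u ≡ true → update sy (side Π) v ≡ true → u ≢ v →
      (adj G u v ≡ true → update py (part Π) u ≢ update py (part Π) v) ×
      (update py (part Π) u ≢ update py (part Π) v → adj G u v ≡ true)
    inA u v su sv u≢v with u ≟ y | v ≟ y
    ... | yes refl | yes refl = contradiction refl u≢v
    ... | yes refl | no v≢y  = toA su v v≢y sv
    ... | no u≢y  | yes refl =
      let (to , from) = toA sv u u≢y su
      in (λ uy → ≢-sym (to (trans (adj-sym G y u) uy))) ,
         (λ ≢ → trans (adj-sym G u y) (from (≢-sym ≢)))
    ... | no u≢y  | no v≢y  = multipartite Π u v u≢y v≢y su sv u≢v
    inB : ∀ u v → update sy (side Π) u ≡ false → update sy (side Π) v ≡ false → u ≢ v →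
      (adj G u v ≡ true → update cy (comp Π) u ≡ update cy (comp Π) v) ×
      (update cy (comp Π) u ≡ update cy (comp Π) v → adj G u v ≡ true)
    inB u v su sv u≢v with u ≟ y | v ≟ y
    ... | yes refl | yes refl = contradiction refl u≢v
    ... | yes refl | no v≢y  = toB su v v≢y sv
    ... | no u≢y  | yes refl =
      let (to , from) = toB sv u u≢y su
      in (λ uy → sym (to (trans (adj-sym G y u) uy))) ,
         (λ ≡ → trans (adj-sym G u y) (from (sym ≡)))
    ... | no u≢y  | no v≢y  = cluster Π u v u≢y v≢y su sv u≢v

extend-at-clique-component : ∀ {k} (G : Graph) {C y} → CliqueComponent G C → C y →
  (Π : PolarPartitionOn (fin 1) k (adj G) (_≢ y)) →
  ((∃ λ v → v ≢ y × side Π v ≡ true) →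
     ∃ λ c → ∀ v → v ≢ y → side Π v ≡ false → comp Π v ≢ c) →
  Polar (fin 1) k G
extend-at-clique-component G {y = y} cc Cy Π free
  with any? (λ z → (adj G y z Bool.≟ true) ×-dec (side Π z Bool.≟ false))
... | yes (z , yz , sz) = extend G Π false zero (comp Π z) (λ ()) (λ _ → join-component z yz sz)
  where
  open CliqueComponent cc
  join-component : ∀ z → adj G y z ≡ true → side Π z ≡ false → ∀ v → v ≢ y → side Π v ≡ false →
    (adj G y v ≡ true → comp Π z ≡ comp Π v) × (comp Π z ≡ comp Π v → adj G y v ≡ true)
  join-component z yz sz v v≢y sv with v ≟ z
  ... | yes refl = (λ _ → refl) , (λ _ → yz)
  ... | no v≢z   =
    let z≢y = ≢-sym (adj⇒≢ G yz)
        (to , from) = cluster Π z v z≢y v≢y sz sv (≢-sym v≢z)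
    in (λ yv → to (complete (closed Cy yz) (closed Cy yv) (≢-sym v≢z))) ,
       (λ same → complete Cy (closed (closed Cy yz) (from same)) (≢-sym v≢y))
... | no no-B-neighbour with any? (λ v → ¬? (v ≟ y) ×-dec (side Π v Bool.≟ true))
...   | yes A-inhabited =
  let (c , fresh) = free A-inhabited
  in extend G Π false zero c (λ ()) λ _ v v≢y sv →
       (λ yv → ⊥-elim (no-B-neighbour (v , yv , sv))) , (λ c≡ → ⊥-elim (fresh v v≢y sv (sym c≡)))
...   | no A-empty =
  extend G Π true zero (comp Π y) (λ _ v v≢y sv → ⊥-elim (A-empty (v , v≢y , sv))) (λ ())

module _ {s k : ℕ∞} {H : Graph} {P : Fin 3 ⊎ Fin (n H) → Set}
  (Π : PolarPartitionOn s k (unionAdj P3 H) P) where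

  toH : PolarPartitionOn s k (adj H) (P ∘ inj₂)
  toH = pullback inj₂ (λ _ → id) (λ _ _ _ _ → refl) (λ _ _ _ _ → inj₂-injective) Π

  module _ (P3⊆P : ∀ i → P (inj₁ i)) where
    private
      P3-part-≡ : ∀ {h} i → P (inj₂ h) → side Π (inj₂ h) ≡ true → side Π (inj₁ i) ≡ true →
        part Π (inj₁ i) ≡ part Π (inj₂ h)
      P3-part-≡ i ph sh si = part-≡ Π (P3⊆P i) ph si sh (λ ()) refl

    P3-A-independent : IndependentA toH
    P3-A-independent u w pu pw su sw uw = P3-not-cluster λ i → Bool.¬-not λ si →
      proj₁ (multipartite Π (inj₂ u) (inj₂ w) pu pw su sw (adj⇒≢ H uw ∘ inj₂-injective)) uw
        (trans (sym (P3-part-≡ i pu su si)) (P3-part-≡ i pw sw si))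
      where
      P3-not-cluster : ¬ (∀ i → side Π (inj₁ i) ≡ false)
      P3-not-cluster inB =
        let 0~1 = proj₁ (cluster Π _ _ (P3⊆P zero) (P3⊆P (suc zero)) (inB _) (inB _) (λ ())) refl
            1~2 = proj₁ (cluster Π _ _ (P3⊆P (suc zero)) (P3⊆P (suc (suc zero)))
                                 (inB _) (inB _) (λ ())) refl
        in contradiction (proj₂ (cluster Π (inj₁ zero) (inj₁ (suc (suc zero))) (P3⊆P _) (P3⊆P _)
                            (inB _) (inB _) (λ ())) (trans 0~1 1~2)) λ ()

    P3-free-label : ∀ {h} → P (inj₂ h) → side Π (inj₂ h) ≡ true →
      ∃ λ c → ∀ v → P (inj₂ v) → side Π (inj₂ v) ≡ false → comp Π (inj₂ v) ≢ c
    P3-free-label ph sh =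
      comp Π (inj₁ q) , λ v pv sv same →
        contradiction (proj₂ (cluster Π (inj₂ v) (inj₁ q) pv (P3⊆P q) sv sq (λ ())) same) λ ()
      where
      P3-meets-B : ∃ λ i → side Π (inj₁ i) ≡ false
      P3-meets-B with side Π (inj₁ zero) in s₀ | side Π (inj₁ (suc zero)) in s₁
      ... | false | _     = zero , s₀
      ... | true  | false = suc zero , s₁
      ... | true  | true  =
        ⊥-elim (proj₁ (multipartite Π _ _ (P3⊆P zero) (P3⊆P (suc zero)) s₀ s₁ (λ ())) refl
                              (trans (P3-part-≡ zero ph sh s₀) (sym (P3-part-≡ (suc zero) ph sh s₁))))
      q = proj₁ P3-meets-B
      sq = proj₂ P3-meets-B

module _ {s k : ℕ∞} {G : Graph} (Π : PolarPartitionOn s k (adj G) (λ _ → ⊤))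
  {u₀ w₀ : Fin (n G)} (u₀w₀ : adj G u₀ w₀ ≡ true)
  (su₀ : side Π u₀ ≡ true) (sw₀ : side Π w₀ ≡ true) where

  A-reaches : ∀ {a} → side Π a ≡ true → Reach G a u₀
  A-reaches {a} sa with a ≟ u₀ | adj G a u₀ in au₀
  ... | yes refl | _    = here
  ... | no _     | true = step au₀ here
  ... | no a≢u₀  | false =
    step (proj₂ (multipartite Π a w₀ tt tt sa sw₀ a≢w₀) a≁w₀) (step (trans (adj-sym G w₀ u₀) u₀w₀) here)
    where
    a≁w₀ : part Π a ≢ part Π w₀
    a≁w₀ = proj₁ (multipartite Π u₀ w₀ tt tt su₀ sw₀ (adj⇒≢ G u₀w₀)) u₀w₀
         ∘ trans (sym (part-≡ Π tt tt sa su₀ a≢u₀ au₀))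
    a≢w₀ : a ≢ w₀
    a≢w₀ refl = a≁w₀ refl

  reach-or-clique-component : ∀ y → Reach G y u₀ ⊎ ∃ λ C → CliqueComponent G C × C y
  reach-or-clique-component y with side Π y in sy
  ... | true  = inj₁ (A-reaches sy)
  ... | false with any? (λ z → (side Π z Bool.≟ false) ×-dec (comp Π z ≟ᴸ comp Π y) ×-dec
                               any? (λ a → (side Π a Bool.≟ true) ×-dec (adj G z a Bool.≟ true)))
  ...   | yes (z , sz , zy , a , sa , za) = inj₁ (Reach-trans G y-reaches-z (step za (A-reaches sa)))
    where
    y-reaches-z : Reach G y z
    y-reaches-z with y ≟ z
    ... | yes refl = here
    ... | no y≢z   = step (proj₂ (cluster Π y z tt tt sy sz y≢z) (sym zy)) here
  ...   | no isolated = inj₂ (InClass , record { closed = closed ; complete = complete } , sy , refl)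
    where
    InClass : Fin (n G) → Set
    InClass z = side Π z ≡ false × comp Π z ≡ comp Π y
    closed : ∀ {z t} → InClass z → adj G z t ≡ true → InClass t
    closed {z} {t} (sz , zy) zt with side Π t in st
    ... | true  = ⊥-elim (isolated (z , sz , zy , t , st , zt))
    ... | false = refl , trans (sym (proj₁ (cluster Π z t tt tt sz st (adj⇒≢ G zt)) zt)) zy
    complete : ∀ {u v} → InClass u → InClass v → u ≢ v → adj G u v ≡ true
    complete (su , uy) (sv , vy) u≢v = proj₂ (cluster Π _ _ tt tt su sv u≢v) (trans uy (sym vy))

module _ {s k : ℕ∞} {G H : Graph} (minimal : MinimalObstruction s k G) (iso : G ≅ (P3 ⊕ H)) where

  clique-component⇒polar : ∀ {C y} → CliqueComponent H C → C y → Polar (fin 1) k H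
  clique-component⇒polar {y = y} cc Cy = extend-at-clique-component H cc Cy H−y free
    where
    Π : PolarPartitionOn s k (unionAdj P3 H) (_≢ inj₂ y)
    Π = sum-delete minimal iso (inj₂ y)
    P3⊆ : ∀ i → inj₁ i ≢ inj₂ y
    P3⊆ i ()
    H−y : PolarPartitionOn (fin 1) k (adj H) (_≢ y)
    H−y = restrict (λ v v≢y → v≢y ∘ inj₂-injective) (merge-parts (toH Π) (P3-A-independent Π P3⊆))
    free : (∃ λ v → v ≢ y × side H−y v ≡ true) →
      ∃ λ c → ∀ v → v ≢ y → side H−y v ≡ false → comp H−y v ≢ c
    free (h , h≢y , sh) =
      let (c , fresh) = P3-free-label Π P3⊆ (h≢y ∘ inj₂-injective) sh
      in c , λ v v≢y → fresh v (v≢y ∘ inj₂-injective)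

  private
    H-partition : PolarPartitionOn s k (adj H) (λ _ → ⊤)
    H-partition = restrict (λ _ _ ()) (toH (sum-delete minimal iso (inj₁ zero)))

  connected : ¬ Polar (fin 1) k H → Connected H
  connected ¬polar with any? (λ u → any? (λ w →
    (side H-partition u Bool.≟ true) ×-dec (side H-partition w Bool.≟ true) ×-dec
    (adj H u w Bool.≟ true)))
  ... | no no-A-edge = ⊥-elim (¬polar (On⇒Polar (merge-parts H-partition
          λ u w _ _ su sw uw → no-A-edge (u , w , su , sw , uw))))
  ... | yes (u₀ , w₀ , su₀ , sw₀ , u₀w₀) = connected-via H u₀ λ y →
    [ id , (λ (_ , cc , Cy) → ⊥-elim (¬polar (clique-component⇒polar cc Cy))) ]
      (reach-or-clique-component H-partition u₀w₀ su₀ sw₀ y)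

complete⇒polar : ∀ {k} (G : Graph) → (∀ u v → u ≢ v → adj G u v ≡ true) →
  Polar (fin 1) (fin (ℕ.suc k)) G
complete⇒polar G complete = record
  { side = λ _ → false
  ; part = λ _ → zero
  ; comp = λ _ → zero
  ; multipartite = λ _ _ ()
  ; cluster = λ u v _ _ u≢v → (λ _ → refl) , (λ _ → complete u v u≢v) }

nonComplete? : ∀ G → Dec (NonComplete G)
nonComplete? G = any? λ u → any? λ v → ¬? (u ≟ v) ×-dec (adj G u v Bool.≟ false)

non-polar⇒nonComplete : ∀ {k} (G : Graph) → ¬ Polar (fin 1) (fin (ℕ.suc k)) G → NonComplete G
non-polar⇒nonComplete G ¬polar = decidable-stable (nonComplete? G) λ complete →
  ¬polar (complete⇒polar G λ u v u≢v → Bool.¬-not λ uv → complete (u , v , u≢v , uv))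

lemma6 : (k : ℕ) → 1 ≤ k → (G H : Graph) → Cograph G →
    MinimalObstruction ∞ (fin k) G → G ≅ (P3 ⊕ H) →
    ¬ Polar (fin 1) (fin k) H → Connected H × NonComplete H
lemma6 _ (s≤s _) G H _ minimal iso ¬polar =
  connected minimal iso ¬polar , non-polar⇒nonComplete H ¬polar
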